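{- Let $\mathcal{G}=((V,E),\lambda)$ be a temporal clique on $n$ nodes with labels exactly $1,\dots,T$, $T=n(n-1)/2$, and representation $\mathcal{R}(\mathcal{G})=(u_1,v_1,1),\dots,(u_T,v_T,T)$. Let $\pi$ be an ordering of $V$ excluding the four forbidden ordered patterns. Set $\pi_0=\pi$ and, for $t=1,\dots,T$, let $\tau_t=(i,j)$ where $i,j$ are the positions of $u_t$ and $v_t$ in $\pi_{t-1}$, and $\pi_t=\pi_{t-1}\tau_t$ (the ordering obtained from $\pi_{t-1}$ by exchanging $u_t$ and $v_t$). Then every $\tau_t$ is an adjacent transposition (i.e. $|i-j|=1$), the sequence $f(\mathcal{G},\pi):=\tau_1,\dots,\tau_T$ is a reduced decomposition of $w_n$, and the sequence $x=(u_1v_1,\dots,u_Tv_T)$ is a 1D-mobility schedule from $\pi$ with $\mathcal{G}$ isomorphic to $\mathcal{G}_{\pi,x}$; in particular $\mathcal{G}$ is a 1D-mobility temporal clique.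
   Context: A temporal clique $\mathcal{G}=((V,E),\lambda)$ is a complete graph on $n$ nodes with each edge given a single label, labels pairwise distinct; its representation $\mathcal{R}(\mathcal{G})$ is the list of triples $(u,v,\lambda(uv))$ sorted by label. An ordering of $V$ is viewed as a map from positions $\{1,\dots,n\}$ to $V$; composing with a transposition $(i,j)$ of positions exchanges the elements at positions $i$ and $j$. An ordering excludes the four forbidden ordered patterns if for every three nodes $a,b,c$ appearing in this order, $\lambda(ac)$ is the median of $\{\lambda(ab),\lambda(ac),\lambda(bc)\}$. 1D-mobility model: agents lie on a line in an initial ordering $\pi$. A 1D-mobility schedule from $\pi$ is a sequence $x=(x_1,\dots,x_T)$ of pairs where, with $\pi_0=\pi$, each $x_t=\{u,v\}$ consists of two agents consecutive in $\pi_{t-1}$ and $\pi_t$ is obtained by exchanging them. $\mathcal{G}_{\pi,x}$ is the temporal graph with edge $uv$ at time $t$ whenever $x_t=uv$. A 1D-mobility temporal clique is a temporal clique isomorphic (via a label-preserving vertex bijection) to some $\mathcal{G}_{\pi,x}$. $w_n\in\mathcal{S}_n$ is the permutation $n,n-1,\dots,1$. An adjacent transposition is $(i,i+1)$. A reduced decomposition of $w_n$ is a sequence of $n(n-1)/2$ adjacent transpositions whose product is $w_n$ (this is the minimal possible length). -}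

module Defs where

open import Data.Nat using (ℕ; zero; suc; _*_; _∸_; _≤_; _<_)
open import Data.Nat.DivMod using (_/_)
open import Data.Fin using (Fin; zero; suc; toℕ; inject₁; opposite)
open import Data.Fin.Permutation using (Permutation; _⟨$⟩ʳ_; _⟨$⟩ˡ_; transpose; _∘ₚ_)
import Data.Fin.Permutation.Components as PC
open import Data.Product using (Σ; ∃; _×_; _,_; proj₁; proj₂)
open import Data.Sum using (_⊎_)
open import Relation.Nullary using (¬_)
open import Relation.Binary.PropositionalEquality using (_≡_; _≢_)
open import Function.Bundles using (_⇔_)

numEdges : ℕ → ℕ
numEdges n = (n * (n ∸ 1)) / 2

-- A labelling of the edges of the complete graph on V = Fin n.
-- λ u v is the label of edge uv (values on the diagonal are irrelevant).
Labelling : ℕ → Set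
Labelling n = Fin n → Fin n → ℕ

record IsTemporalCliqueLabels (n : ℕ) (λ' : Labelling n) : Set where
  field
    symmetric  : ∀ u v → λ' u v ≡ λ' v u
    distinct   : ∀ u v u' v' → u ≢ v → u' ≢ v' → λ' u v ≡ λ' u' v' →
                 (u ≡ u' × v ≡ v') ⊎ (u ≡ v' × v ≡ u')
    inRange    : ∀ u v → u ≢ v → 1 ≤ λ' u v × λ' u v ≤ numEdges n
    surjective : ∀ t → 1 ≤ t → t ≤ numEdges n → Σ (Fin n) λ u → Σ (Fin n) λ v → u ≢ v × λ' u v ≡ t

-- R(G) = (u_1,v_1,1), ..., (u_T,v_T,T): rep t = (u_{t+1}, v_{t+1}) (0-based index t).
IsRepresentation : (n : ℕ) → Labelling n → (Fin (numEdges n) → Fin n × Fin n) → Set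
IsRepresentation n λ' rep =
  ∀ t → proj₁ (rep t) ≢ proj₂ (rep t) × λ' (proj₁ (rep t)) (proj₂ (rep t)) ≡ suc (toℕ t)

-- Orderings: permutations mapping positions to nodes (π ⟨$⟩ʳ p = node at position p).
Ordering : ℕ → Set
Ordering n = Permutation n n

MedianAC : ℕ → ℕ → ℕ → Set
MedianAC ab ac bc = (ab ≤ ac × ac ≤ bc) ⊎ (bc ≤ ac × ac ≤ ab)

ExcludesForbiddenPatterns : {n : ℕ} → Labelling n → Ordering n → Set
ExcludesForbiddenPatterns λ' π =
  ∀ p q r → toℕ p < toℕ q → toℕ q < toℕ r →
  MedianAC (λ' (π ⟨$⟩ʳ p) (π ⟨$⟩ʳ q)) (λ' (π ⟨$⟩ʳ p) (π ⟨$⟩ʳ r)) (λ' (π ⟨$⟩ʳ q) (π ⟨$⟩ʳ r))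

positions : {n : ℕ} → Ordering n → Fin n × Fin n → Fin n × Fin n
positions π (u , v) = (π ⟨$⟩ˡ u , π ⟨$⟩ˡ v)

-- π' = π τ where τ = (i j), i.e. π' p = π (τ p): exchange u and v in π.
exchange : {n : ℕ} → Ordering n → Fin n × Fin n → Ordering n
exchange π e = transpose (proj₁ (positions π e)) (proj₂ (positions π e)) ∘ₚ π

ordAt : {n m : ℕ} → Ordering n → (Fin m → Fin n × Fin n) → Fin (suc m) → Ordering n
ordAt π x zero = π
ordAt {m = suc m} π x (suc k) = ordAt (exchange π (x zero)) (λ i → x (suc i)) k

-- τ_{t+1} = (i, j): positions of the (t+1)-th pair in π_t (0-based t).
tau : {n m : ℕ} → Ordering n → (Fin m → Fin n × Fin n) → Fin m → Fin n × Fin n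
tau π x t = positions (ordAt π x (inject₁ t)) (x t)

IsAdjacent : {n : ℕ} → Fin n × Fin n → Set
IsAdjacent (i , j) = suc (toℕ i) ≡ toℕ j ⊎ suc (toℕ j) ≡ toℕ i

product : {n m : ℕ} → (Fin m → Fin n × Fin n) → Fin n → Fin n
product {m = zero} τ p = p
product {m = suc m} τ p = PC.transpose (proj₁ (τ zero)) (proj₂ (τ zero)) (product (λ i → τ (suc i)) p)

-- w_n : p ↦ n + 1 - p (1-based), i.e. Fin.opposite.
-- A reduced decomposition of w_n: n(n-1)/2 adjacent transpositions whose product is w_n.
IsReducedDecompositionOfW : (n : ℕ) → (Fin (numEdges n) → Fin n × Fin n) → Set
IsReducedDecompositionOfW n τ = (∀ t → IsAdjacent (τ t)) × (∀ p → product τ p ≡ opposite p)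

IsMobilitySchedule : {n m : ℕ} → Ordering n → (Fin m → Fin n × Fin n) → Set
IsMobilitySchedule π x = ∀ t → IsAdjacent (positions (ordAt π x (inject₁ t)) (x t))

-- Temporal graphs on Fin n given by their edge-at-time relation: E u v t
-- means edge uv is present at time t.
TemporalGraph : ℕ → Set₁
TemporalGraph n = Fin n → Fin n → ℕ → Set

cliqueGraph : {n : ℕ} → Labelling n → TemporalGraph n
cliqueGraph λ' u v t = u ≢ v × λ' u v ≡ t

-- G_{π,x}: edge uv at time t (1-based) whenever x_t = uv.
scheduleGraph : {n m : ℕ} → (Fin m → Fin n × Fin n) → TemporalGraph n
scheduleGraph {m = m} x u v t =
  Σ (Fin m) λ i → suc (toℕ i) ≡ t × (x i ≡ (u , v) ⊎ x i ≡ (v , u))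

Isomorphic : {n : ℕ} → TemporalGraph n → TemporalGraph n → Set
Isomorphic {n} E E' = Σ (Permutation n n) λ φ → ∀ u v t → E u v t ⇔ E' (φ ⟨$⟩ʳ u) (φ ⟨$⟩ʳ v) t

IsOneDMobilityClique : {n : ℕ} → Labelling n → Set
IsOneDMobilityClique {n} λ' =
  Σ (Ordering n) λ π → Σ ℕ λ m → Σ (Fin m → Fin n × Fin n) λ x →
    IsMobilitySchedule π x × Isomorphic (cliqueGraph λ') (scheduleGraph x)

{-# OPTIONS --safe #-}
-- The invariant is that π_t is π with exactly the pairs of label at most t inverted.
-- Let uv be the edge labelled t+1, with u before v in π and hence in π_t. No node c
-- lies strictly between u and v in π_t: whatever the π-position of c, the invariant
-- places the two labels involving c relative to t+1 so that the label of the π-outer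
-- pair of {u, v, c} is not the median of the three. So u and v are consecutive,
-- exchanging them is an adjacent transposition, and the invariant passes to t+1.
-- At t = T every pair is inverted, hence τ_1⋯τ_T = π⁻¹ π_T is an order-reversing
-- permutation of the positions, i.e. w_n. The schedule graph is the clique itself,
-- so the identity is an isomorphism.
module Submission where

open import Defs
open import Data.Nat using (ℕ; zero; suc; _+_; _≤_; _<_; z≤n; s≤s)
open import Data.Nat.Properties
open import Data.Fin as Fin using (Fin; zero; suc; toℕ; fromℕ; fromℕ<; opposite)
open import Data.Fin.Properties
  using (toℕ-injective; toℕ-fromℕ<; fromℕ<-toℕ; toℕ<n; opposite-prop; opposite-involutive)
import Data.Fin.Properties as Fin
open import Data.Fin.Permutation using (_⟨$⟩ʳ_; _⟨$⟩ˡ_; inverseˡ; inverseʳ; id)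
import Data.Fin.Permutation.Components as PC
open import Data.Product using (_×_; _,_; proj₁; proj₂; uncurry)
open import Data.Sum as Sum using (_⊎_; inj₁; inj₂)
open import Data.Empty using (⊥; ⊥-elim)
open import Function using (_∘_)
open import Function.Bundles using (mk⇔)
open import Relation.Nullary using (¬_; Dec; yes; no; contradiction)
open import Relation.Binary using (_Preserves_⟶_; tri<; tri≈; tri>)
open import Relation.Binary.PropositionalEquality
  using (_≡_; _≢_; refl; sym; trans; cong; cong₂; subst; subst₂; module ≡-Reasoning)

opposite-reverses-≤ : ∀ {n} {p q : Fin n} → p Fin.≤ q → opposite q Fin.≤ opposite p
opposite-reverses-≤ {n} {p} {q} p≤q =
  subst₂ _≤_ (sym (opposite-prop q)) (sym (opposite-prop p)) (∸-monoʳ-≤ n (s≤s p≤q))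

opposite-reverses-< : ∀ {n} {p q : Fin n} → p Fin.< q → opposite q Fin.< opposite p
opposite-reverses-< {n} {p} {q} p<q =
  subst₂ _<_ (sym (opposite-prop q)) (sym (opposite-prop p)) (∸-monoʳ-< (s≤s p<q) (toℕ<n q))

strictlyIncreasing⇒inflationary : ∀ {n} (h : Fin n → Fin n) →
  h Preserves Fin._<_ ⟶ Fin._<_ → ∀ p → p Fin.≤ h p
strictlyIncreasing⇒inflationary {n} h increasing p =
  subst (λ q → toℕ p ≤ toℕ (h q)) (fromℕ<-toℕ p (toℕ<n p)) (bound (toℕ p) (toℕ<n p))
  where
  bound : ∀ k (k<n : k < n) → k ≤ toℕ (h (fromℕ< k<n))
  bound zero    _   = z≤n
  bound (suc k) k<n = ≤-<-trans (bound k k′<n) (increasing fromℕ<-k<fromℕ<-suc-k)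
    where
    k′<n : k < n
    k′<n = <-trans (n<1+n k) k<n
    fromℕ<-k<fromℕ<-suc-k : fromℕ< k′<n Fin.< fromℕ< k<n
    fromℕ<-k<fromℕ<-suc-k = subst₂ _<_ (sym (toℕ-fromℕ< k′<n)) (sym (toℕ-fromℕ< k<n)) (n<1+n k)

strictlyDecreasing⇒opposite : ∀ {n} (g : Fin n → Fin n) →
  g Preserves Fin._<_ ⟶ Fin._>_ → ∀ p → g p ≡ opposite p
strictlyDecreasing⇒opposite g decreasing p = Fin.≤-antisym upper lower
  where
  upper : g p Fin.≤ opposite p
  upper = subst (Fin._≤ opposite p) (opposite-involutive (g p))
    (opposite-reverses-≤ (strictlyIncreasing⇒inflationary (opposite ∘ g)
      (λ p<q → opposite-reverses-< (decreasing p<q)) p))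
  lower : opposite p Fin.≤ g p
  lower = subst (λ q → opposite p Fin.≤ g q) (opposite-involutive p)
    (strictlyIncreasing⇒inflationary (g ∘ opposite)
      (λ p<q → decreasing (opposite-reverses-< p<q)) (opposite p))

SameEdge : ∀ {n} → Fin n × Fin n → Fin n × Fin n → Set
SameEdge (a , b) (u , v) = (a ≡ u × b ≡ v) ⊎ (a ≡ v × b ≡ u)

SameEdge-flip : ∀ {n} {a b u v : Fin n} → SameEdge (b , a) (u , v) → SameEdge (a , b) (u , v)
SameEdge-flip (inj₁ (b≡u , a≡v)) = inj₂ (a≡v , b≡u)
SameEdge-flip (inj₂ (b≡v , a≡u)) = inj₁ (a≡u , b≡v)

transpose-first : ∀ {n} {i j k : Fin n} → k ≡ i → PC.transpose i j k ≡ j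
transpose-first {i = i} {k = k} k≡i with k Fin.≟ i
... | yes _   = refl
... | no k≢i = contradiction k≡i k≢i

transpose-second : ∀ {n} {i j k : Fin n} → k ≡ j → PC.transpose i j k ≡ i
transpose-second {i = i} {j} {k} k≡j with k Fin.≟ i
... | yes k≡i = trans (sym k≡j) k≡i
... | no _ with k Fin.≟ j
...   | yes _   = refl
...   | no k≢j = contradiction k≡j k≢j

transpose-fixes : ∀ {n} {i j k : Fin n} → k ≢ i → k ≢ j → PC.transpose i j k ≡ k
transpose-fixes {i = i} {j} {k} k≢i k≢j with k Fin.≟ i
... | yes k≡i = contradiction k≡i k≢i
... | no _ with k Fin.≟ j
...   | yes k≡j = contradiction k≡j k≢j
...   | no _    = refl

adjacent-below : ∀ {n} {i j k : Fin n} → IsAdjacent (i , j) → k ≢ j → k Fin.< i → k Fin.< j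
adjacent-below (inj₁ i+1≡j) _   k<i = <-trans k<i (≤-reflexive i+1≡j)
adjacent-below (inj₂ j+1≡i) k≢j k<i =
  ≤∧≢⇒< (≤-pred (≤-trans k<i (≤-reflexive (sym j+1≡i)))) (k≢j ∘ toℕ-injective)

adjacent-above : ∀ {n} {i j k : Fin n} → IsAdjacent (i , j) → k ≢ j → i Fin.< k → j Fin.< k
adjacent-above (inj₁ i+1≡j) k≢j i<k =
  ≤∧≢⇒< (≤-trans (≤-reflexive (sym i+1≡j)) i<k) (k≢j ∘ sym ∘ toℕ-injective)
adjacent-above (inj₂ j+1≡i) _   i<k = <-trans (≤-reflexive j+1≡i) i<k

transpose-adjacent-< : ∀ {n} {i j p q : Fin n} → IsAdjacent (i , j) →
  ¬ SameEdge (p , q) (i , j) → p Fin.< q → PC.transpose i j p Fin.< PC.transpose i j q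
transpose-adjacent-< {i = i} {j} {p} {q} adj ¬same p<q = by-cases (p Fin.≟ i) (p Fin.≟ j)
  where
  τ = PC.transpose i j

  moved-first : p ≡ i → j Fin.< τ q
  moved-first p≡i = subst (j Fin.<_) (sym (transpose-fixes q≢i q≢j))
    (adjacent-above adj q≢j (subst (Fin._< q) p≡i p<q))
    where
    q≢i : q ≢ i
    q≢i q≡i = Fin.<-irrefl (trans p≡i (sym q≡i)) p<q
    q≢j : q ≢ j
    q≢j q≡j = ¬same (inj₁ (p≡i , q≡j))

  moved-second : p ≡ j → i Fin.< τ q
  moved-second p≡j = subst (i Fin.<_) (sym (transpose-fixes q≢i q≢j))
    (adjacent-above (Sum.swap adj) q≢i (subst (Fin._< q) p≡j p<q))
    where
    q≢i : q ≢ i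
    q≢i q≡i = ¬same (inj₂ (p≡j , q≡i))
    q≢j : q ≢ j
    q≢j q≡j = Fin.<-irrefl (trans p≡j (sym q≡j)) p<q

  fixed : p ≢ i → p ≢ j → Dec (q ≡ i) → Dec (q ≡ j) → p Fin.< τ q
  fixed p≢i p≢j (yes q≡i) _ =
    subst (p Fin.<_) (sym (transpose-first q≡i)) (adjacent-below adj p≢j (subst (p Fin.<_) q≡i p<q))
  fixed p≢i p≢j (no _) (yes q≡j) =
    subst (p Fin.<_) (sym (transpose-second q≡j)) (adjacent-below (Sum.swap adj) p≢i (subst (p Fin.<_) q≡j p<q))
  fixed p≢i p≢j (no q≢i) (no q≢j) = subst (p Fin.<_) (sym (transpose-fixes q≢i q≢j)) p<q

  by-cases : Dec (p ≡ i) → Dec (p ≡ j) → τ p Fin.< τ q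
  by-cases (yes p≡i) _ = subst (Fin._< τ q) (sym (transpose-first p≡i)) (moved-first p≡i)
  by-cases (no _) (yes p≡j) = subst (Fin._< τ q) (sym (transpose-second p≡j)) (moved-second p≡j)
  by-cases (no p≢i) (no p≢j) =
    subst (Fin._< τ q) (sym (transpose-fixes p≢i p≢j)) (fixed p≢i p≢j (q Fin.≟ i) (q Fin.≟ j))

Before : ∀ {n} → Ordering n → Fin n → Fin n → Set
Before O a b = O ⟨$⟩ˡ a Fin.< O ⟨$⟩ˡ b

Reverses : ∀ {n} → Ordering n → Ordering n → Set
Reverses π O = ∀ {a b} → Before π a b → Before O b a

⟨$⟩ˡ-injective : ∀ {n} (O : Ordering n) {a b} → O ⟨$⟩ˡ a ≡ O ⟨$⟩ˡ b → a ≡ b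
⟨$⟩ˡ-injective O e = trans (sym (inverseʳ O)) (trans (cong (O ⟨$⟩ʳ_) e) (inverseʳ O))

Before-≢ : ∀ {n} (O : Ordering n) {a b} → Before O a b → a ≢ b
Before-≢ O a<b refl = <-irrefl refl a<b

-- exchange O (u , v) ⟨$⟩ˡ a reduces to PC.transpose (O ⟨$⟩ˡ v) (O ⟨$⟩ˡ u) (O ⟨$⟩ˡ a).
exchange-⟨$⟩ˡ-first : ∀ {n} (O : Ordering n) (u v : Fin n) → exchange O (u , v) ⟨$⟩ˡ u ≡ O ⟨$⟩ˡ v
exchange-⟨$⟩ˡ-first O u v = transpose-second {i = O ⟨$⟩ˡ v} {j = O ⟨$⟩ˡ u} refl

exchange-⟨$⟩ˡ-second : ∀ {n} (O : Ordering n) (u v : Fin n) → exchange O (u , v) ⟨$⟩ˡ v ≡ O ⟨$⟩ˡ u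
exchange-⟨$⟩ˡ-second O u v = transpose-first {i = O ⟨$⟩ˡ v} {j = O ⟨$⟩ˡ u} refl

exchange-reverses : ∀ {n} (O : Ordering n) {u v a b} → SameEdge (a , b) (u , v) →
  Before O a b → Before (exchange O (u , v)) b a
exchange-reverses O {u} {v} (inj₁ (refl , refl)) =
  subst₂ Fin._<_ (sym (exchange-⟨$⟩ˡ-second O u v)) (sym (exchange-⟨$⟩ˡ-first O u v))
exchange-reverses O {u} {v} (inj₂ (refl , refl)) =
  subst₂ Fin._<_ (sym (exchange-⟨$⟩ˡ-first O u v)) (sym (exchange-⟨$⟩ˡ-second O u v))

exchange-preserves : ∀ {n} (O : Ordering n) {u v a b} → IsAdjacent (positions O (u , v)) →
  ¬ SameEdge (a , b) (u , v) → Before O a b → Before (exchange O (u , v)) a b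
exchange-preserves O adj ¬same = transpose-adjacent-< (Sum.swap adj) ¬same-positions
  where
  ¬same-positions : ¬ SameEdge _ _
  ¬same-positions (inj₁ (a≡v , b≡u)) = ¬same (inj₂ (⟨$⟩ˡ-injective O a≡v , ⟨$⟩ˡ-injective O b≡u))
  ¬same-positions (inj₂ (a≡u , b≡v)) = ¬same (inj₁ (⟨$⟩ˡ-injective O a≡u , ⟨$⟩ˡ-injective O b≡v))

consecutive-if-nothing-between : ∀ {n} (O : Ordering n) {a b} → Before O a b →
  (∀ c → Before O a c → Before O c b → ⊥) → suc (toℕ (O ⟨$⟩ˡ a)) ≡ toℕ (O ⟨$⟩ˡ b)
consecutive-if-nothing-between {n} O {a} {b} a<b nothing-between with m≤n⇒m<n∨m≡n a<b
... | inj₂ consecutive = consecutive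
... | inj₁ gap =
  ⊥-elim (nothing-between c (≤-reflexive (sym c-position)) (subst (_< toℕ (O ⟨$⟩ˡ b)) (sym c-position) gap))
  where
  a+1<n : suc (toℕ (O ⟨$⟩ˡ a)) < n
  a+1<n = <-trans gap (toℕ<n (O ⟨$⟩ˡ b))
  c : Fin n
  c = O ⟨$⟩ʳ fromℕ< a+1<n
  c-position : toℕ (O ⟨$⟩ˡ c) ≡ suc (toℕ (O ⟨$⟩ˡ a))
  c-position = trans (cong toℕ (inverseˡ O)) (toℕ-fromℕ< a+1<n)

reverses⇒strictlyDecreasing : ∀ {n} (π O : Ordering n) → Reverses π O →
  (λ p → π ⟨$⟩ˡ (O ⟨$⟩ʳ p)) Preserves Fin._<_ ⟶ Fin._>_
reverses⇒strictlyDecreasing π O reverses {p} {q} p<q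
  with Fin.<-cmp (π ⟨$⟩ˡ (O ⟨$⟩ʳ p)) (π ⟨$⟩ˡ (O ⟨$⟩ʳ q))
... | tri> _ _ q<p = q<p
... | tri≈ _ e _ = contradiction p<q (Fin.<-irrefl p≡q)
  where
  p≡q : p ≡ q
  p≡q = trans (sym (inverseˡ O)) (trans (cong (O ⟨$⟩ˡ_) (⟨$⟩ˡ-injective π e)) (inverseˡ O))
... | tri< p<q′ _ _ = contradiction p<q (<-asym (subst₂ Fin._<_ (inverseˡ O) (inverseˡ O) (reverses p<q′)))

ordAt-fromℕ-⟨$⟩ʳ : ∀ {n m} (O : Ordering n) (x : Fin m → Fin n × Fin n) p →
  ordAt O x (fromℕ m) ⟨$⟩ʳ p ≡ O ⟨$⟩ʳ product (tau O x) p
ordAt-fromℕ-⟨$⟩ʳ {m = zero}  O x p = refl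
ordAt-fromℕ-⟨$⟩ʳ {m = suc m} O x p = ordAt-fromℕ-⟨$⟩ʳ (exchange O (x zero)) (λ i → x (suc i)) p

product-tau≡opposite : ∀ {n m} (π : Ordering n) (x : Fin m → Fin n × Fin n) →
  Reverses π (ordAt π x (fromℕ m)) → ∀ p → product (tau π x) p ≡ opposite p
product-tau≡opposite {m = m} π x reverses p = begin
  product (tau π x) p                   ≡⟨ inverseˡ π ⟨
  π ⟨$⟩ˡ (π ⟨$⟩ʳ product (tau π x) p)    ≡⟨ cong (π ⟨$⟩ˡ_) (ordAt-fromℕ-⟨$⟩ʳ π x p) ⟨
  π ⟨$⟩ˡ (ordAt π x (fromℕ m) ⟨$⟩ʳ p)    ≡⟨ strictlyDecreasing⇒opposite _
                                             (reverses⇒strictlyDecreasing π (ordAt π x (fromℕ m)) reverses) p ⟩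
  opposite p                            ∎
  where open ≡-Reasoning

median-≤ : ∀ {x y z s} → MedianAC x y z → x ≤ s → z ≤ s → y ≤ s
median-≤ (inj₁ (_ , y≤z)) _   z≤s = ≤-trans y≤z z≤s
median-≤ (inj₂ (_ , y≤x)) x≤s _   = ≤-trans y≤x x≤s

median-≥ : ∀ {x y z s} → MedianAC x y z → s ≤ x → s ≤ z → s ≤ y
median-≥ (inj₁ (x≤y , _)) s≤x _   = ≤-trans s≤x x≤y
median-≥ (inj₂ (z≤y , _)) _   s≤z = ≤-trans s≤z z≤y

module _ {n : ℕ} (λ' : Labelling n) (π : Ordering n) where

  record InvertedUpTo (t : ℕ) (O : Ordering n) : Set where
    field
      inverts : ∀ {a b} → Before π a b → λ' a b ≤ t → Before O b a
      keeps   : ∀ {a b} → Before π a b → t < λ' a b → Before O a b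

  open InvertedUpTo

  label-above : ∀ {t O a b} → InvertedUpTo t O → Before π a b → Before O a b → t < λ' a b
  label-above inv a<b a<ᴼb = ≰⇒> (λ ab≤t → <-asym a<ᴼb (inverts inv a<b ab≤t))

  label-below : ∀ {t O a b} → InvertedUpTo t O → Before π a b → Before O b a → λ' a b ≤ t
  label-below inv a<b b<ᴼa = ≮⇒≥ (λ t<ab → <-asym b<ᴼa (keeps inv a<b t<ab))

  module _ (clique : IsTemporalCliqueLabels n λ') where
    open IsTemporalCliqueLabels clique

    SameEdge⇒≡label : ∀ {a b u v} → SameEdge (a , b) (u , v) → λ' a b ≡ λ' u v
    SameEdge⇒≡label         (inj₁ (refl , refl)) = refl
    SameEdge⇒≡label {a} {b} (inj₂ (refl , refl)) = symmetric a b

    inverted-initially : InvertedUpTo 0 π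
    inverts inverted-initially a<b ab≤0 =
      contradiction (≤-trans (proj₁ (inRange _ _ (Before-≢ π a<b))) ab≤0) n≮0
    keeps inverted-initially a<b _ = a<b

    inverted-finally : ∀ {O} → InvertedUpTo (numEdges n) O → Reverses π O
    inverted-finally inv a<b = inverts inv a<b (proj₂ (inRange _ _ (Before-≢ π a<b)))

    label-above-next : ∀ {t O a b u v} → InvertedUpTo t O → u ≢ v → λ' u v ≡ suc t →
      Before π a b → Before O a b → ¬ SameEdge (a , b) (u , v) → suc t < λ' a b
    label-above-next inv u≢v uv≡ a<b a<ᴼb ¬same =
      ≤∧≢⇒< (label-above inv a<b a<ᴼb)
        (λ e → ¬same (distinct _ _ _ _ (Before-≢ π a<b) u≢v (trans (sym e) (sym uv≡))))

    inverted-step : ∀ {t O u v} → InvertedUpTo t O → u ≢ v → λ' u v ≡ suc t →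
      IsAdjacent (positions O (u , v)) → InvertedUpTo (suc t) (exchange O (u , v))
    inverts (inverted-step {t} {O} {u} {v} inv u≢v uv≡ adj) {a} {b} a<b ab≤t+1 with λ' a b ≟ suc t
    ... | yes ab≡ = exchange-reverses O same (keeps inv a<b (≤-reflexive (sym ab≡)))
      where
      same : SameEdge (a , b) (u , v)
      same = distinct a b u v (Before-≢ π a<b) u≢v (trans ab≡ (sym uv≡))
    ... | no ab≢ = exchange-preserves O adj ¬same (inverts inv a<b (≤-pred (≤∧≢⇒< ab≤t+1 ab≢)))
      where
      ¬same : ¬ SameEdge (b , a) (u , v)
      ¬same same = ab≢ (trans (SameEdge⇒≡label (SameEdge-flip same)) uv≡)
    keeps (inverted-step {t} {O} {u} {v} inv _ uv≡ adj) {a} {b} a<b t+1<ab =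
      exchange-preserves O adj ¬same (keeps inv a<b (<-trans (n<1+n t) t+1<ab))
      where
      ¬same : ¬ SameEdge (a , b) (u , v)
      ¬same same = <-irrefl (trans (sym uv≡) (sym (SameEdge⇒≡label same))) t+1<ab

    module _ (excludes : ExcludesForbiddenPatterns λ' π) where

      median-of-triple : ∀ {a b c} → Before π a b → Before π b c → MedianAC (λ' a b) (λ' a c) (λ' b c)
      median-of-triple {a} {b} {c} a<b b<c with excludes (π ⟨$⟩ˡ a) (π ⟨$⟩ˡ b) (π ⟨$⟩ˡ c) a<b b<c
      ... | median rewrite inverseʳ π {a} | inverseʳ π {b} | inverseʳ π {c} = median

      nothing-between : ∀ {t O u v} → InvertedUpTo t O → Before π u v → λ' u v ≡ suc t →
        ∀ c → Before O u c → Before O c v → ⊥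
      nothing-between {t} {O} {u} {v} inv u<v uv≡ c u<ᴼc c<ᴼv = impossible
        where
        u≢v : u ≢ v
        u≢v = Before-≢ π u<v
        c≢u : c ≢ u
        c≢u = Before-≢ O u<ᴼc ∘ sym
        ¬same-cv : ¬ SameEdge (c , v) (u , v)
        ¬same-cv (inj₁ (c≡u , _)) = c≢u c≡u
        ¬same-cv (inj₂ (c≡v , _)) = Before-≢ O c<ᴼv c≡v
        ¬same-uc : ¬ SameEdge (u , c) (u , v)
        ¬same-uc (inj₁ (_ , c≡v)) = Before-≢ O c<ᴼv c≡v
        ¬same-uc (inj₂ (u≡v , _)) = u≢v u≡v
        impossible : ⊥
        impossible with Fin.<-cmp (π ⟨$⟩ˡ c) (π ⟨$⟩ˡ u) | Fin.<-cmp (π ⟨$⟩ˡ c) (π ⟨$⟩ˡ v)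
        ... | tri≈ _ c≡u _ | _ = c≢u (⟨$⟩ˡ-injective π c≡u)
        ... | tri< c<u _ _ | _ =
          <⇒≱ (label-above-next inv u≢v uv≡ (<-trans c<u u<v) c<ᴼv ¬same-cv)
              (median-≤ (median-of-triple c<u u<v)
                (≤-trans (label-below inv c<u u<ᴼc) (n≤1+n t)) (≤-reflexive uv≡))
        ... | tri> _ _ u<c | tri≈ _ c≡v _ = Before-≢ O c<ᴼv (⟨$⟩ˡ-injective π c≡v)
        ... | tri> _ _ u<c | tri< c<v _ _ =
          <⇒≱ (n<1+n (suc t))
              (subst (suc (suc t) ≤_) uv≡ (median-≥ (median-of-triple u<c c<v)
                (label-above-next inv u≢v uv≡ u<c u<ᴼc ¬same-uc)
                (label-above-next inv u≢v uv≡ c<v c<ᴼv ¬same-cv)))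
        ... | tri> _ _ u<c | tri> _ _ v<c =
          <⇒≱ (label-above-next inv u≢v uv≡ u<c u<ᴼc ¬same-uc)
              (median-≤ (median-of-triple u<v v<c)
                (≤-reflexive uv≡) (≤-trans (label-below inv v<c c<ᴼv) (n≤1+n t)))

      consecutive-at-step : ∀ {t O u v} → InvertedUpTo t O → Before π u v → λ' u v ≡ suc t →
        suc (toℕ (O ⟨$⟩ˡ u)) ≡ toℕ (O ⟨$⟩ˡ v)
      consecutive-at-step {O = O} inv u<v uv≡ =
        consecutive-if-nothing-between O (keeps inv u<v (≤-reflexive (sym uv≡))) (nothing-between inv u<v uv≡)

      adjacent-at-step : ∀ {t O u v} → InvertedUpTo t O → u ≢ v → λ' u v ≡ suc t →
        IsAdjacent (positions O (u , v))
      adjacent-at-step {u = u} {v} inv u≢v uv≡ with Fin.<-cmp (π ⟨$⟩ˡ u) (π ⟨$⟩ˡ v)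
      ... | tri< u<v _ _ = inj₁ (consecutive-at-step inv u<v uv≡)
      ... | tri≈ _ e _   = contradiction (⟨$⟩ˡ-injective π e) u≢v
      ... | tri> _ _ v<u = inj₂ (consecutive-at-step inv v<u (trans (symmetric v u) uv≡))

      inverted-run : ∀ {m} t O (x : Fin m → Fin n × Fin n) → InvertedUpTo t O →
        (∀ i → cliqueGraph λ' (proj₁ (x i)) (proj₂ (x i)) (suc (t + toℕ i))) →
        IsMobilitySchedule O x × InvertedUpTo (t + m) (ordAt O x (fromℕ m))
      inverted-run {zero} t O _ inv _ =
        (λ ()) , subst (λ k → InvertedUpTo k O) (sym (+-identityʳ t)) inv
      inverted-run {suc m} t O x inv labels =
        schedule , subst (λ k → InvertedUpTo k (ordAt O x (fromℕ (suc m)))) (sym (+-suc t m)) (proj₂ rest)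
        where
        u≢v : proj₁ (x zero) ≢ proj₂ (x zero)
        u≢v = proj₁ (labels zero)
        uv≡ : λ' (proj₁ (x zero)) (proj₂ (x zero)) ≡ suc t
        uv≡ = trans (proj₂ (labels zero)) (cong suc (+-identityʳ t))
        first-adjacent : IsAdjacent (positions O (x zero))
        first-adjacent = adjacent-at-step inv u≢v uv≡
        rest = inverted-run (suc t) (exchange O (x zero)) (λ i → x (suc i))
          (inverted-step inv u≢v uv≡ first-adjacent)
          (λ i → proj₁ (labels (suc i)) , trans (proj₂ (labels (suc i))) (cong suc (+-suc t (toℕ i))))
        schedule : IsMobilitySchedule O x
        schedule zero    = first-adjacent
        schedule (suc i) = proj₁ rest i

module _ {n : ℕ} {λ' : Labelling n} (clique : IsTemporalCliqueLabels n λ')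
         {rep : Fin (numEdges n) → Fin n × Fin n} (representation : IsRepresentation n λ' rep) where
  open IsTemporalCliqueLabels clique

  clique⇒schedule : ∀ u v t → cliqueGraph λ' u v t → scheduleGraph rep u v t
  clique⇒schedule u v zero (u≢v , uv≡0) =
    contradiction (subst (1 ≤_) uv≡0 (proj₁ (inRange u v u≢v))) n≮0
  clique⇒schedule u v (suc t) (u≢v , uv≡) =
    i , cong suc (toℕ-fromℕ< t<T) ,
    Sum.map (uncurry (cong₂ _,_)) (uncurry (cong₂ _,_))
      (distinct _ _ u v (proj₁ (representation i))
        u≢v (trans (proj₂ (representation i)) (trans (cong suc (toℕ-fromℕ< t<T)) (sym uv≡))))
    where
    t<T : t < numEdges n
    t<T = subst (_≤ numEdges n) uv≡ (proj₂ (inRange u v u≢v))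
    i : Fin (numEdges n)
    i = fromℕ< t<T

  schedule⇒clique : ∀ u v t → scheduleGraph rep u v t → cliqueGraph λ' u v t
  schedule⇒clique _ _ _ (i , refl , inj₁ refl) = representation i
  schedule⇒clique _ _ _ (i , refl , inj₂ refl) =
    proj₁ (representation i) ∘ sym , trans (symmetric _ _) (proj₂ (representation i))

  clique≅schedule : Isomorphic (cliqueGraph λ') (scheduleGraph rep)
  clique≅schedule = id , λ u v t → mk⇔ (clique⇒schedule u v t) (schedule⇒clique u v t)

mainTheorem4 : (n : ℕ) (λ' : Labelling n) → IsTemporalCliqueLabels n λ' →
    (rep : Fin (numEdges n) → Fin n × Fin n) → IsRepresentation n λ' rep →
    (π : Ordering n) → ExcludesForbiddenPatterns λ' π →
    ((∀ t → IsAdjacent (tau π rep t))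
     × IsReducedDecompositionOfW n (tau π rep)
     × IsMobilitySchedule π rep
     × Isomorphic (cliqueGraph λ') (scheduleGraph rep)
     × IsOneDMobilityClique λ')
mainTheorem4 n λ' clique rep representation π excludes =
  schedule , (schedule , product-tau≡opposite π rep reversed) , schedule , iso ,
  (π , numEdges n , rep , schedule , iso)
  where
  run = inverted-run λ' π clique excludes 0 π rep (inverted-initially λ' π clique) representation
  schedule : IsMobilitySchedule π rep
  schedule = proj₁ run
  reversed : Reverses π (ordAt π rep (fromℕ (numEdges n)))
  reversed = inverted-finally λ' π clique (proj₂ run)
  iso : Isomorphic (cliqueGraph λ') (scheduleGraph rep)
  iso = clique≅schedule clique representation
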